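{- Let $T$ be a set of (not necessarily binary) rooted phylogenetic trees on the same leaf set $X$. If $s$ is a cherry picking sequence for $T$ and $x\in H(T)$ satisfies $w_T(x)=0$, then there is a cherry picking sequence $s'$ for $T$ with $w_T(s')=w_T(s)$ and $s'_1=x$.
   Context: A (non-binary) tree on $X$ is a rooted tree whose non-leaf vertices have out-degree at least 2 and whose leaves are bijectively labelled by $X$. For a set $A$ of leaves, $\mathcal{T}\setminus A$ is obtained by deleting the leaves in $A$ and repeatedly suppressing vertices with in- and out-degree one; $T\setminus A=\{\mathcal{T}\setminus A:\mathcal{T}\in T\}$. A cherry of $\mathcal{T}$ is the set of children of a vertex all of whose children are leaves. $N_{\mathcal{T}}(x)$ is the set of leaves $y\neq x$ in a common cherry with $x$; $N_T(x)=\bigcup_{\mathcal{T}\in T}N_{\mathcal{T}}(x)$. A neighbor cover of $x$ in $T$ is $S\subseteq N_T(x)$ with $S\cap N_{\mathcal{T}}(x)\neq\emptyset$ for all $\mathcal{T}\in T$; $w_T(x)$ is the minimum size of a neighbor cover minus one. $H(T)=\{x:N_{\mathcal{T}}(x)\neq\emptyset\ \forall\mathcal{T}\in T\}$. With $n=|X|$, a cherry picking sequence for $T$ is a sequence of leaves $s=(s_1,\dots,s_{n-1})$ with $s_i\in H(T\setminus\{s_1,\dots,s_{i-1}\})$ for all $i$; its weight is $w_T(s)=\sum_{i=1}^{n-1}w_{T\setminus\{s_1,\dots,s_{i-1}\}}(s_i)$. -}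

module Defs where

open import Data.Nat using (ℕ; _≤_; _≟_; suc)
open import Data.Integer using (ℤ; +_; _-_; _+_)
open import Data.List using (List; []; _∷_; length; [_]; _++_; concatMap; filter)
open import Data.List.Membership.Propositional using (_∈_)
open import Data.List.Relation.Unary.All using (All)
open import Data.List.Relation.Unary.Unique.Propositional using (Unique)
open import Data.Product using (Σ; ∃; _×_; _,_)
open import Data.Unit using (⊤)
open import Relation.Binary.PropositionalEquality using (_≡_; _≢_)
open import Relation.Nullary using (¬_; yes; no)
open import Relation.Nullary.Decidable using (¬?)

data Tree : Set where
  leaf : ℕ → Tree
  node : List Tree → Tree

data WF : Tree → Set where
  leafWF : ∀ {x} → WF (leaf x)
  nodeWF : ∀ {cs} → 2 ≤ length cs → All WF cs → WF (node cs)

mutual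
  leaves : Tree → List ℕ
  leaves (leaf x) = [ x ]
  leaves (node cs) = leavesL cs

  leavesL : List Tree → List ℕ
  leavesL [] = []
  leavesL (c ∷ cs) = leaves c ++ leavesL cs

record TreeOn (X : List ℕ) (t : Tree) : Set where
  field
    wf     : WF t
    uniq   : Unique (leaves t)
    leafSet : ∀ y → (y ∈ leaves t → y ∈ X) × (y ∈ X → y ∈ leaves t)

record TreesOn (X : List ℕ) (T : List Tree) : Set where
  field
    uniqX : Unique X
    trees : All (TreeOn X) T

-- Deleting leaf x and suppressing the resulting vertex of out-degree one
-- (a root of out-degree one is removed as well).  Returns [] if the whole
-- tree disappears, otherwise a singleton.
mutual
  del : ℕ → Tree → List Tree
  del x (leaf y) with y ≟ x
  ... | yes _ = []
  ... | no  _ = leaf y ∷ []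
  del x (node cs) = collapse (delL x cs)

  delL : ℕ → List Tree → List Tree
  delL x [] = []
  delL x (c ∷ cs) = del x c ++ delL x cs

  collapse : List Tree → List Tree
  collapse [] = []
  collapse (c ∷ []) = c ∷ []
  collapse (c ∷ d ∷ cs) = node (c ∷ d ∷ cs) ∷ []

delSet : ℕ → List Tree → List Tree
delSet x T = concatMap (del x) T

remove : ℕ → List ℕ → List ℕ
remove x X = filter (λ y → ¬? (y ≟ x)) X

data Sub : Tree → Tree → Set where
  here  : ∀ {t} → Sub t t
  there : ∀ {u c cs} → c ∈ cs → Sub u c → Sub u (node cs)

data IsLeaf : Tree → Set where
  isLeaf : ∀ {x} → IsLeaf (leaf x)

-- y ∈ N_𝒯(x): y ≠ x and x, y lie in a common cherry of 𝒯
-- (the children of a vertex all of whose children are leaves).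
Nbr : Tree → ℕ → ℕ → Set
Nbr t x y = x ≢ y × Σ (List Tree) (λ cs →
  Sub (node cs) t × All IsLeaf cs × leaf x ∈ cs × leaf y ∈ cs)

NeighborCover : List Tree → ℕ → List ℕ → Set
NeighborCover T x S =
  (∀ y → y ∈ S → Σ Tree (λ t → t ∈ T × Nbr t x y)) ×
  (∀ t → t ∈ T → Σ ℕ (λ y → y ∈ S × Nbr t x y))

MinCover : List Tree → ℕ → ℕ → Set
MinCover T x m =
  Σ (List ℕ) (λ S → Unique S × NeighborCover T x S × length S ≡ m) ×
  (∀ S → Unique S → NeighborCover T x S → m ≤ length S)

Weight : List Tree → ℕ → ℤ → Set
Weight T x w = Σ ℕ (λ m → MinCover T x m × w ≡ (+ m) - (+ 1))

InH : List ℕ → List Tree → ℕ → Set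
InH X T x = x ∈ X × (∀ t → t ∈ T → Σ ℕ (λ y → Nbr t x y))

-- Stepwise condition s_i ∈ H(T \ {s_1,…,s_{i-1}}), tracking the leaf set.
ValidSeq : List ℕ → List Tree → List ℕ → Set
ValidSeq X T [] = ⊤
ValidSeq X T (x ∷ s) = InH X T x × ValidSeq (remove x X) (delSet x T) s

CPS : List ℕ → List Tree → List ℕ → Set
CPS X T s = suc (length s) ≡ length X × ValidSeq X T s

data SeqWeight : List ℕ → List Tree → List ℕ → ℤ → Set where
  wnil  : ∀ {X T} → SeqWeight X T [] (+ 0)
  wcons : ∀ {X T x s w k} → Weight T x w →
          SeqWeight (remove x X) (delSet x T) s k →
          SeqWeight X T (x ∷ s) (w + k)

module Submission where

-- If w_T(x) = 0, a minimum neighbor cover of x is a single leaf y, so x and y share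
-- a cherry in every tree of T.  Given a cherry picking sequence s of weight k, split
-- on the first occurrence of x or y in s; one of them occurs, since a sequence
-- avoiding two leaves of X is too short.
-- * x first, s = p ++ x ∷ q: then x ∷ p ++ q has the same weight.  Deleting x
--   commutes with the other deletions, preserves H-membership and weights of every
--   z ∉ {x, y} (a neighbor cover of z is transported by replacing x with y), and x
--   has weight 0 at any time while it shares a cherry with y.
-- * y first: exchange the labels x and y throughout s.  As x and y are siblings,
--   the exchange maps each tree to itself up to the order of children; this
--   equivalence preserves cherries and commutes with deletion, so the exchanged
--   sequence has the same weight and reduces to the first case.

open import Defs
open import Data.Nat using (ℕ; zero; suc; _≤_; z≤n; s≤s; _≟_)
open import Data.Nat.Properties using (≤-trans; ≤-refl; ≤-antisym; 1+n≰n)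
open import Data.Integer using (ℤ; +_; _-_)
open import Data.Integer.Properties using (+-identityˡ)
open import Data.List using (List; []; _∷_; _++_; length; map)
open import Data.List.Properties
  using (filter-accept; filter-reject; filter-notAll; filter-++; ++-identityʳ; ++-assoc;
         length-filter; length-map; map-++; length-++-sucʳ)
open import Data.List.Membership.Propositional using (_∈_; _∉_; find)
open import Data.List.Membership.Propositional.Properties
  using (∈-filter⁺; ∈-filter⁻; ∈-++⁻; ∈-++⁺ˡ; ∈-++⁺ʳ; ∈-concatMap⁺; ∈-concatMap⁻; ∈-map⁺; ∈-map⁻)
open import Data.List.Membership.DecPropositional _≟_ using (_∈?_)
open import Data.List.Relation.Unary.Any using (here; there)
import Data.List.Relation.Unary.Any as Any
open import Data.List.Relation.Unary.All using (All; []; _∷_)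
import Data.List.Relation.Unary.All as All
import Data.List.Relation.Unary.All.Properties as All
open import Data.List.Relation.Unary.Unique.Propositional using (Unique)
open import Data.List.Relation.Unary.AllPairs using ([]; _∷_)
import Data.List.Relation.Unary.Unique.Propositional.Properties as Unique
open import Data.Product using (Σ; _×_; _,_; proj₁; proj₂)
open import Data.Sum using (_⊎_; inj₁; inj₂)
open import Data.Empty using (⊥; ⊥-elim)
open import Data.Unit using (tt)
open import Function using (case_of_)
open import Relation.Binary.PropositionalEquality
open import Relation.Nullary using (Dec; yes; no)
open import Relation.Nullary.Decidable using (¬?)

weight-zero⇒size-one : ∀ m → (+ m) - (+ 1) ≡ + 0 → m ≡ 1
weight-zero⇒size-one (suc zero) _ = refl

remove-head-≡ : ∀ {z a} X → z ≡ a → remove a (z ∷ X) ≡ remove a X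
remove-head-≡ {z} {a} X z≡a = filter-reject (λ y → ¬? (y ≟ a)) (λ z≢a → z≢a z≡a)

remove-head-≢ : ∀ {z a} X → z ≢ a → remove a (z ∷ X) ≡ z ∷ remove a X
remove-head-≢ {z} {a} X = filter-accept (λ y → ¬? (y ≟ a))

∈-remove⁺ : ∀ {v a X} → v ∈ X → v ≢ a → v ∈ remove a X
∈-remove⁺ {a = a} = ∈-filter⁺ (λ y → ¬? (y ≟ a))

∈-remove⁻ : ∀ {v a} X → v ∈ remove a X → v ∈ X × v ≢ a
∈-remove⁻ {a = a} X = ∈-filter⁻ (λ y → ¬? (y ≟ a)) {xs = X}

remove-comm : ∀ a b X → remove a (remove b X) ≡ remove b (remove a X)
remove-comm a b [] = refl
remove-comm a b (z ∷ X) with z ≟ a | z ≟ b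
... | yes z≡a | yes z≡b = begin
  remove a (remove b (z ∷ X)) ≡⟨ cong (remove a) (remove-head-≡ X z≡b) ⟩
  remove a (remove b X)       ≡⟨ remove-comm a b X ⟩
  remove b (remove a X)       ≡⟨ cong (remove b) (remove-head-≡ X z≡a) ⟨
  remove b (remove a (z ∷ X)) ∎
  where open ≡-Reasoning
... | yes z≡a | no z≢b = begin
  remove a (remove b (z ∷ X)) ≡⟨ cong (remove a) (remove-head-≢ X z≢b) ⟩
  remove a (z ∷ remove b X)   ≡⟨ remove-head-≡ (remove b X) z≡a ⟩
  remove a (remove b X)       ≡⟨ remove-comm a b X ⟩
  remove b (remove a X)       ≡⟨ cong (remove b) (remove-head-≡ X z≡a) ⟨
  remove b (remove a (z ∷ X)) ∎
  where open ≡-Reasoning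
... | no z≢a | yes z≡b = begin
  remove a (remove b (z ∷ X)) ≡⟨ cong (remove a) (remove-head-≡ X z≡b) ⟩
  remove a (remove b X)       ≡⟨ remove-comm a b X ⟩
  remove b (remove a X)       ≡⟨ remove-head-≡ (remove a X) z≡b ⟨
  remove b (z ∷ remove a X)   ≡⟨ cong (remove b) (remove-head-≢ X z≢a) ⟨
  remove b (remove a (z ∷ X)) ∎
  where open ≡-Reasoning
... | no z≢a | no z≢b = begin
  remove a (remove b (z ∷ X))   ≡⟨ cong (remove a) (remove-head-≢ X z≢b) ⟩
  remove a (z ∷ remove b X)     ≡⟨ remove-head-≢ (remove b X) z≢a ⟩
  z ∷ remove a (remove b X)     ≡⟨ cong (z ∷_) (remove-comm a b X) ⟩
  z ∷ remove b (remove a X)     ≡⟨ remove-head-≢ (remove a X) z≢b ⟨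
  remove b (z ∷ remove a X)     ≡⟨ cong (remove b) (remove-head-≢ X z≢a) ⟨
  remove b (remove a (z ∷ X))   ∎
  where open ≡-Reasoning

remove-length : ∀ {a} X → a ∈ X → suc (length (remove a X)) ≤ length X
remove-length {a} X a∈X =
  filter-notAll (λ y → ¬? (y ≟ a)) X (Any.map (λ y≡a y≢a → y≢a (sym y≡a)) a∈X)

remove-++ : ∀ a xs ys → remove a (xs ++ ys) ≡ remove a xs ++ remove a ys
remove-++ a = filter-++ (λ y → ¬? (y ≟ a))

remove-unique : ∀ {a} X → Unique X → Unique (remove a X)
remove-unique {a} X = Unique.filter⁺ (λ y → ¬? (y ≟ a))

unique-++⁻ : ∀ {A : Set} (xs : List A) {ys} → Unique (xs ++ ys) →
             Unique xs × Unique ys × (∀ {v} → v ∈ xs → v ∈ ys → ⊥)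
unique-++⁻ [] u = [] , u , λ ()
unique-++⁻ (x ∷ xs) (x∉ ∷ u) =
  let (uxs , uys , disjoint) = unique-++⁻ xs u
      (x∉xs , x∉ys) = All.++⁻ xs x∉
  in (x∉xs ∷ uxs) , uys , λ { (here refl) v∈ys → All.lookup x∉ys v∈ys refl
                            ; (there v∈xs) v∈ys → disjoint v∈xs v∈ys }

two-members : ∀ {A : Set} {a b : A} (l : List A) → a ∈ l → b ∈ l → a ≢ b → 2 ≤ length l
two-members (_ ∷ []) (here refl) (here refl) a≢b = ⊥-elim (a≢b refl)
two-members (_ ∷ _ ∷ _) _ _ _ = s≤s (s≤s z≤n)

member⇒nonempty : ∀ {A : Set} {a : A} {l} → a ∈ l → 1 ≤ length l
member⇒nonempty {l = _ ∷ _} _ = s≤s z≤n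

∈-singleton : ∀ {A : Set} {u v : A} → u ∈ v ∷ [] → u ≡ v
∈-singleton (here u≡v) = u≡v

length-one : ∀ {A : Set} (l : List A) → length l ≡ 1 → Σ A (λ a → l ≡ a ∷ [])
length-one (a ∷ []) _ = a , refl

Small : List Tree → Set
Small l = l ≡ [] ⊎ Σ Tree (λ u → l ≡ u ∷ [])

collapse-small : ∀ l → Small (collapse l)
collapse-small [] = inj₁ refl
collapse-small (c ∷ []) = inj₂ (c , refl)
collapse-small (c ∷ d ∷ cs) = inj₂ (_ , refl)

data LeafDeletion (a y : ℕ) : Set where
  deleted : y ≡ a → del a (leaf y) ≡ [] → LeafDeletion a y
  kept    : y ≢ a → del a (leaf y) ≡ leaf y ∷ [] → LeafDeletion a y

del-leaf-≡ : ∀ {a y} → y ≡ a → del a (leaf y) ≡ []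
del-leaf-≡ {a} {y} y≡a with y ≟ a
... | yes _ = refl
... | no y≢a = ⊥-elim (y≢a y≡a)

del-leaf-≢ : ∀ {a y} → y ≢ a → del a (leaf y) ≡ leaf y ∷ []
del-leaf-≢ {a} {y} y≢a with y ≟ a
... | yes y≡a = ⊥-elim (y≢a y≡a)
... | no _ = refl

leafDeletion : ∀ a y → LeafDeletion a y
leafDeletion a y with y ≟ a
... | yes y≡a = deleted y≡a (del-leaf-≡ y≡a)
... | no y≢a = kept y≢a (del-leaf-≢ y≢a)

del-small : ∀ a t → Small (del a t)
del-small a (leaf y) with leafDeletion a y
... | deleted _ eq = inj₁ eq
... | kept _ eq = inj₂ (leaf y , eq)
del-small a (node cs) = collapse-small (delL a cs)

small-++-[] : ∀ {l} → Small l → l ++ [] ≡ l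
small-++-[] (inj₁ refl) = refl
small-++-[] (inj₂ (_ , refl)) = refl

collapse-small-id : ∀ {l} → Small l → collapse l ≡ l
collapse-small-id (inj₁ refl) = refl
collapse-small-id (inj₂ (_ , refl)) = refl

∈-small : ∀ {l u} → Small l → u ∈ l → l ≡ u ∷ []
∈-small (inj₂ (_ , refl)) (here refl) = refl
∈-small (inj₂ (_ , refl)) (there ())

del-at-most-one : ∀ {a t u u′} → u ∈ del a t → u′ ∈ del a t → u′ ≡ u
del-at-most-one {a} {t} u∈ u′∈ = ∈-singleton (subst (_ ∈_) (∈-small (del-small a t) u∈) u′∈)

delL-++ : ∀ a xs ys → delL a (xs ++ ys) ≡ delL a xs ++ delL a ys
delL-++ a [] ys = refl
delL-++ a (x ∷ xs) ys = trans (cong (del a x ++_) (delL-++ a xs ys)) (sym (++-assoc (del a x) _ _))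

delL-collapse : ∀ b l → delL b (collapse l) ≡ collapse (delL b l)
delL-collapse b [] = refl
delL-collapse b (c ∷ []) = begin
  del b c ++ []            ≡⟨ small-++-[] (del-small b c) ⟩
  del b c                  ≡⟨ collapse-small-id (del-small b c) ⟨
  collapse (del b c)       ≡⟨ cong collapse (small-++-[] (del-small b c)) ⟨
  collapse (del b c ++ []) ∎
  where open ≡-Reasoning
delL-collapse b (c ∷ d ∷ cs) = small-++-[] (collapse-small (delL b (c ∷ d ∷ cs)))

mutual
  del-comm : ∀ a b t → delL b (del a t) ≡ delL a (del b t)
  del-comm a b (leaf y) with leafDeletion a y | leafDeletion b y
  ... | deleted _ ea | deleted _ eb rewrite ea | eb = refl
  ... | deleted _ ea | kept _ eb rewrite ea | eb | ea = refl
  ... | kept _ ea | deleted _ eb rewrite ea | eb = refl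
  ... | kept _ ea | kept _ eb rewrite ea | eb | ea = refl
  del-comm a b (node cs) = begin
    delL b (collapse (delL a cs)) ≡⟨ delL-collapse b (delL a cs) ⟩
    collapse (delL b (delL a cs)) ≡⟨ cong collapse (delL-comm a b cs) ⟩
    collapse (delL a (delL b cs)) ≡⟨ delL-collapse a (delL b cs) ⟨
    delL a (collapse (delL b cs)) ∎
    where open ≡-Reasoning

  delL-comm : ∀ a b cs → delL b (delL a cs) ≡ delL a (delL b cs)
  delL-comm a b [] = refl
  delL-comm a b (c ∷ cs) = begin
    delL b (del a c ++ delL a cs)           ≡⟨ delL-++ b (del a c) (delL a cs) ⟩
    delL b (del a c) ++ delL b (delL a cs)  ≡⟨ cong₂ _++_ (del-comm a b c) (delL-comm a b cs) ⟩
    delL a (del b c) ++ delL a (delL b cs)  ≡⟨ delL-++ a (del b c) (delL b cs) ⟨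
    delL a (del b c ++ delL b cs)           ∎
    where open ≡-Reasoning

delSet≡delL : ∀ a T → delSet a T ≡ delL a T
delSet≡delL a [] = refl
delSet≡delL a (t ∷ T) = cong (del a t ++_) (delSet≡delL a T)

delSet-comm : ∀ a b T → delSet b (delSet a T) ≡ delSet a (delSet b T)
delSet-comm a b T = begin
  delSet b (delSet a T) ≡⟨ delSet≡delL b (delSet a T) ⟩
  delL b (delSet a T)   ≡⟨ cong (delL b) (delSet≡delL a T) ⟩
  delL b (delL a T)     ≡⟨ delL-comm a b T ⟩
  delL a (delL b T)     ≡⟨ cong (delL a) (delSet≡delL b T) ⟨
  delL a (delSet b T)   ≡⟨ delSet≡delL a (delSet b T) ⟨
  delSet a (delSet b T) ∎
  where open ≡-Reasoning

∈-delL⁻ : ∀ {a u} cs → u ∈ delL a cs → Σ Tree (λ c → c ∈ cs × u ∈ del a c)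
∈-delL⁻ {a} cs u∈ = find (∈-concatMap⁻ (del a) (subst (_ ∈_) (sym (delSet≡delL a cs)) u∈))

∈-delL⁺ : ∀ {a u c} cs → c ∈ cs → u ∈ del a c → u ∈ delL a cs
∈-delL⁺ {a} cs c∈ u∈ = subst (_ ∈_) (delSet≡delL a cs) (∈-concatMap⁺ (del a) (Any.map (λ { refl → u∈ }) c∈))

∈-delSet⁻ : ∀ {a u} T → u ∈ delSet a T → Σ Tree (λ t → t ∈ T × u ∈ del a t)
∈-delSet⁻ {a} T u∈ = find (∈-concatMap⁻ (del a) u∈)

∈-delSet⁺ : ∀ {a u t} T → t ∈ T → u ∈ del a t → u ∈ delSet a T
∈-delSet⁺ {a} T t∈ u∈ = ∈-concatMap⁺ (del a) (Any.map (λ { refl → u∈ }) t∈)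

leavesL-++ : ∀ xs ys → leavesL (xs ++ ys) ≡ leavesL xs ++ leavesL ys
leavesL-++ [] ys = refl
leavesL-++ (x ∷ xs) ys = trans (cong (leaves x ++_) (leavesL-++ xs ys)) (sym (++-assoc (leaves x) _ _))

leavesL-collapse : ∀ l → leavesL (collapse l) ≡ leavesL l
leavesL-collapse [] = refl
leavesL-collapse (c ∷ []) = refl
leavesL-collapse (c ∷ d ∷ cs) = ++-identityʳ _

mutual
  leaves-del : ∀ a t → leavesL (del a t) ≡ remove a (leaves t)
  leaves-del a (leaf y) with leafDeletion a y
  ... | deleted y≡a eq rewrite eq = sym (remove-head-≡ [] y≡a)
  ... | kept y≢a eq rewrite eq = sym (remove-head-≢ [] y≢a)
  leaves-del a (node cs) = trans (leavesL-collapse (delL a cs)) (leaves-delL a cs)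

  leaves-delL : ∀ a cs → leavesL (delL a cs) ≡ remove a (leavesL cs)
  leaves-delL a [] = refl
  leaves-delL a (c ∷ cs) = begin
    leavesL (del a c ++ delL a cs)                 ≡⟨ leavesL-++ (del a c) (delL a cs) ⟩
    leavesL (del a c) ++ leavesL (delL a cs)       ≡⟨ cong₂ _++_ (leaves-del a c) (leaves-delL a cs) ⟩
    remove a (leaves c) ++ remove a (leavesL cs)   ≡⟨ remove-++ a (leaves c) (leavesL cs) ⟨
    remove a (leaves c ++ leavesL cs)              ∎
    where open ≡-Reasoning

del-unique-leaves : ∀ {a t u} → Unique (leaves t) → u ∈ del a t → Unique (leaves u)
del-unique-leaves {a} {t} {u} ut u∈ = subst Unique (sym leaves-u) (remove-unique (leaves t) ut)
  where
  leaves-u : leaves u ≡ remove a (leaves t)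
  leaves-u = begin
    leaves u               ≡⟨ ++-identityʳ (leaves u) ⟨
    leavesL (u ∷ [])       ≡⟨ cong leavesL (∈-small (del-small a t) u∈) ⟨
    leavesL (del a t)      ≡⟨ leaves-del a t ⟩
    remove a (leaves t)    ∎
    where open ≡-Reasoning

∈-leavesL : ∀ {y c} cs → c ∈ cs → y ∈ leaves c → y ∈ leavesL cs
∈-leavesL (c ∷ cs) (here refl) y∈ = ∈-++⁺ˡ y∈
∈-leavesL (c ∷ cs) (there c∈) y∈ = ∈-++⁺ʳ (leaves c) (∈-leavesL cs c∈ y∈)

leaf∈⇒label∈ : ∀ {y} cs → leaf y ∈ cs → y ∈ leavesL cs
leaf∈⇒label∈ cs y∈ = ∈-leavesL cs y∈ (here refl)

Sub-leaves : ∀ {y u t} → Sub u t → y ∈ leaves u → y ∈ leaves t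
Sub-leaves here y∈ = y∈
Sub-leaves (there {cs = cs} c∈ sub) y∈ = ∈-leavesL cs c∈ (Sub-leaves sub y∈)

Sub-trans : ∀ {u v t} → Sub u v → Sub v t → Sub u t
Sub-trans sub here = sub
Sub-trans sub (there c∈ sub′) = there c∈ (Sub-trans sub sub′)

leaf-inj : ∀ {p q} → leaf p ≡ leaf q → p ≡ q
leaf-inj refl = refl

no-vertex-below-leaf : ∀ {D z} → Sub (node D) (leaf z) → ⊥
no-vertex-below-leaf ()

Nbr-leaves : ∀ {t p q} → Nbr t p q → q ∈ leaves t
Nbr-leaves (_ , C , C⊑t , _ , _ , q∈C) = Sub-leaves C⊑t (leaf∈⇒label∈ _ q∈C)

unique-child : ∀ {c} cs → Unique (leavesL cs) → c ∈ cs → Unique (leaves c)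
unique-child (c ∷ cs) u (here refl) = proj₁ (unique-++⁻ (leaves c) u)
unique-child (c ∷ cs) u (there c∈) = unique-child cs (proj₁ (proj₂ (unique-++⁻ (leaves c) u))) c∈

child-by-label : ∀ {z c₁ c₂} cs → Unique (leavesL cs) → c₁ ∈ cs → c₂ ∈ cs →
                 z ∈ leaves c₁ → z ∈ leaves c₂ → c₁ ≡ c₂
child-by-label (c ∷ cs) u (here refl) (here refl) _ _ = refl
child-by-label (c ∷ cs) u (here refl) (there c₂∈) z∈₁ z∈₂ =
  ⊥-elim (proj₂ (proj₂ (unique-++⁻ (leaves c) u)) z∈₁ (∈-leavesL cs c₂∈ z∈₂))
child-by-label (c ∷ cs) u (there c₁∈) (here refl) z∈₁ z∈₂ =
  ⊥-elim (proj₂ (proj₂ (unique-++⁻ (leaves c) u)) z∈₂ (∈-leavesL cs c₁∈ z∈₁))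
child-by-label (c ∷ cs) u (there c₁∈) (there c₂∈) z∈₁ z∈₂ =
  child-by-label cs (proj₁ (proj₂ (unique-++⁻ (leaves c) u))) c₁∈ c₂∈ z∈₁ z∈₂

parent-unique : ∀ {t C D z} → Unique (leaves t) → Sub (node C) t → Sub (node D) t →
                leaf z ∈ C → leaf z ∈ D → C ≡ D
parent-unique u here here _ _ = refl
parent-unique {node C} u here (there c∈ sub) z∈C z∈D
  with child-by-label C u z∈C c∈ (here refl) (Sub-leaves sub (leaf∈⇒label∈ _ z∈D))
... | refl = ⊥-elim (no-vertex-below-leaf sub)
parent-unique {node D} u (there c∈ sub) here z∈C z∈D
  with child-by-label D u z∈D c∈ (here refl) (Sub-leaves sub (leaf∈⇒label∈ _ z∈C))
... | refl = ⊥-elim (no-vertex-below-leaf sub)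
parent-unique {node cs} u (there c∈ sub) (there c′∈ sub′) z∈C z∈D
  with child-by-label cs u c∈ c′∈ (Sub-leaves sub (leaf∈⇒label∈ _ z∈C)) (Sub-leaves sub′ (leaf∈⇒label∈ _ z∈D))
... | refl = parent-unique (unique-child cs u c∈) sub sub′ z∈C z∈D

collapse-long : ∀ {L} → 2 ≤ length L → collapse L ≡ node L ∷ []
collapse-long {c ∷ d ∷ cs} _ = refl
collapse-long {c ∷ []} (s≤s ())

collapse-∈⁺ : ∀ {u′} L → u′ ∈ L → Σ Tree (λ u → u ∈ collapse L × Sub u′ u)
collapse-∈⁺ (c ∷ []) (here refl) = c , here refl , here
collapse-∈⁺ (c ∷ d ∷ cs) u′∈ = node (c ∷ d ∷ cs) , here refl , there u′∈ here

collapse-∈⁻ : ∀ {u} L → u ∈ collapse L → (L ≡ u ∷ []) ⊎ (u ≡ node L)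
collapse-∈⁻ (c ∷ []) (here refl) = inj₁ refl
collapse-∈⁻ (c ∷ d ∷ cs) (here refl) = inj₂ refl

Sub-del⁺ : ∀ {a C t} → Sub (node C) t → 2 ≤ length (delL a C) →
           Σ Tree (λ u → u ∈ del a t × Sub (node (delL a C)) u)
Sub-del⁺ {a} {C} here long = node (delL a C) , subst (node (delL a C) ∈_) (sym (collapse-long long)) (here refl) , here
Sub-del⁺ {a} (there {cs = cs} c∈ sub) long =
  let (u′ , u′∈ , sub′) = Sub-del⁺ sub long
      (u , u∈ , u′⊑u) = collapse-∈⁺ (delL a cs) (∈-delL⁺ cs c∈ u′∈)
  in u , u∈ , Sub-trans sub′ u′⊑u

mutual
  Sub-del⁻ : ∀ {a ds u} t → Sub (node ds) u → u ∈ del a t →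
             Σ (List Tree) (λ cs → Sub (node cs) t × ds ≡ delL a cs)
  Sub-del⁻ {a} (leaf y) sub u∈ with leafDeletion a y
  ... | deleted _ eq rewrite eq = case u∈ of λ ()
  ... | kept _ eq rewrite eq with u∈
  ...   | here refl = ⊥-elim (no-vertex-below-leaf sub)
  Sub-del⁻ {a} {u = u} (node cs) sub u∈ with collapse-∈⁻ (delL a cs) u∈
  ... | inj₁ eq =
    let (E , (c , c∈ , E⊑c) , eqE) = Sub-delL⁻ cs sub (subst (u ∈_) (sym eq) (here refl))
    in E , there c∈ E⊑c , eqE
  Sub-del⁻ (node cs) here u∈ | inj₂ refl = cs , here , refl
  Sub-del⁻ (node cs) (there d∈ sub) u∈ | inj₂ refl =
    let (E , (c , c∈ , E⊑c) , eqE) = Sub-delL⁻ cs sub d∈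
    in E , there c∈ E⊑c , eqE

  Sub-delL⁻ : ∀ {a ds u} cs → Sub (node ds) u → u ∈ delL a cs →
              Σ (List Tree) (λ E → Σ Tree (λ c → c ∈ cs × Sub (node E) c) × ds ≡ delL a E)
  Sub-delL⁻ {a} (c ∷ cs) sub u∈ with ∈-++⁻ (del a c) u∈
  ... | inj₁ u∈c = let (E , E⊑c , eq) = Sub-del⁻ c sub u∈c in E , (c , here refl , E⊑c) , eq
  ... | inj₂ u∈cs = let (E , (c′ , c′∈ , E⊑c′) , eq) = Sub-delL⁻ cs sub u∈cs in E , (c′ , there c′∈ , E⊑c′) , eq

mutual
  leaf-del⁻ : ∀ {a z} c → leaf z ∈ del a c →
              (c ≡ leaf z) ⊎ Σ (List Tree) (λ E → Sub (node E) c × leaf z ∈ E × delL a E ≡ leaf z ∷ [])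
  leaf-del⁻ {a} (leaf y) z∈ with leafDeletion a y
  ... | deleted _ eq rewrite eq = case z∈ of λ ()
  ... | kept _ eq rewrite eq with z∈
  ...   | here refl = inj₁ refl
  leaf-del⁻ {a} {z} (node cs) z∈ with collapse-∈⁻ (delL a cs) z∈
  ... | inj₂ ()
  ... | inj₁ eq with leaf-delL⁻ cs (subst (leaf z ∈_) (sym eq) (here refl))
  ...   | inj₁ z∈cs = inj₂ (cs , here , z∈cs , eq)
  ...   | inj₂ (E , (c , c∈ , E⊑c) , z∈E , eqE) = inj₂ (E , there c∈ E⊑c , z∈E , eqE)

  leaf-delL⁻ : ∀ {a z} cs → leaf z ∈ delL a cs →
               leaf z ∈ cs ⊎ Σ (List Tree) (λ E → Σ Tree (λ c → c ∈ cs × Sub (node E) c) × leaf z ∈ E × delL a E ≡ leaf z ∷ [])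
  leaf-delL⁻ {a} (c ∷ cs) z∈ with ∈-++⁻ (del a c) z∈
  ... | inj₁ z∈c with leaf-del⁻ c z∈c
  ...   | inj₁ refl = inj₁ (here refl)
  ...   | inj₂ (E , E⊑c , z∈E , eq) = inj₂ (E , (c , here refl , E⊑c) , z∈E , eq)
  leaf-delL⁻ {a} (c ∷ cs) z∈ | inj₂ z∈cs with leaf-delL⁻ cs z∈cs
  ... | inj₁ z∈cs′ = inj₁ (there z∈cs′)
  ... | inj₂ (E , (c′ , c′∈ , E⊑c′) , z∈E , eq) = inj₂ (E , (c′ , there c′∈ , E⊑c′) , z∈E , eq)

leaf∈delL⁺ : ∀ {a w} cs → leaf w ∈ cs → w ≢ a → leaf w ∈ delL a cs
leaf∈delL⁺ cs w∈ w≢a = ∈-delL⁺ cs w∈ (subst (_ ∈_) (sym (del-leaf-≢ w≢a)) (here refl))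

leafList-delL⁻ : ∀ {a u} cs → All IsLeaf cs → u ∈ delL a cs → u ∈ cs
leafList-delL⁻ {a} cs leafs u∈ with ∈-delL⁻ cs u∈
... | leaf y , c∈ , u∈c with leafDeletion a y
...   | deleted _ eq = case subst (_ ∈_) eq u∈c of λ ()
...   | kept _ eq with subst (_ ∈_) eq u∈c
...     | here refl = c∈
leafList-delL⁻ {a} cs leafs u∈ | node _ , c∈ , _ = case All.lookup leafs c∈ of λ ()

leafList-delL : ∀ {a} cs → All IsLeaf cs → All IsLeaf (delL a cs)
leafList-delL cs leafs = All.tabulate (λ u∈ → All.lookup leafs (leafList-delL⁻ cs leafs u∈))

Nbr-del : ∀ {t p q d} → Nbr t p q → p ≢ d → q ≢ d → Σ Tree (λ u → u ∈ del d t × Nbr u p q)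
Nbr-del {d = d} (p≢q , C , C⊑t , leafs , p∈C , q∈C) p≢d q≢d =
  let p∈ = leaf∈delL⁺ C p∈C p≢d
      q∈ = leaf∈delL⁺ C q∈C q≢d
      (u , u∈ , C′⊑u) = Sub-del⁺ C⊑t (two-members (delL d C) p∈ q∈ (λ eq → p≢q (leaf-inj eq)))
  in u , u∈ , (p≢q , delL d C , C′⊑u , leafList-delL C leafs , p∈ , q∈)

Nbr-del-at : ∀ {t u z w d} → u ∈ del d t → Nbr t z w → z ≢ d → w ≢ d → Nbr u z w
Nbr-del-at {t} {d = d} u∈ nbr z≢d w≢d =
  let (u′ , u′∈ , nbr′) = Nbr-del nbr z≢d w≢d
  in subst (λ v → Nbr v _ _) (del-at-most-one {d} {t} u∈ u′∈) nbr′

-- A leaf with a cherry neighbor is not the whole tree, so deleting it leaves a tree.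
del-nonempty : ∀ {t p q} → Nbr t p q → Σ Tree (λ u → u ∈ del p t)
del-nonempty {t} {p} {q} nbr with del p t | leaves-del p t
... | [] | eq = case subst (q ∈_) (sym eq) (∈-remove⁺ (Nbr-leaves nbr) (λ q≡p → proj₁ nbr (sym q≡p))) of λ ()
... | u ∷ _ | _ = u , here refl

-- Deleting x from trees in which x and y lie in a common cherry: the x-first case.
module CherryDeletion (x y : ℕ) where

  XYCherry : Tree → Set
  XYCherry t = Unique (leaves t) × Nbr t x y

  AllXY : List Tree → Set
  AllXY T = ∀ t → t ∈ T → XYCherry t

  Nonempty : List Tree → Set
  Nonempty T = Σ Tree (λ t → t ∈ T)

  Nbr-x⇒Nbr-y : ∀ {t u z} → XYCherry t → u ∈ del x t → Nbr t z x → z ≢ y → Nbr u z y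
  Nbr-x⇒Nbr-y (ut , x≢y , D , D⊑t , leafsD , x∈D , y∈D) u∈ (z≢x , C , C⊑t , leafsC , z∈C , x∈C) z≢y
    with parent-unique ut C⊑t D⊑t x∈C x∈D
  ... | refl = Nbr-del-at u∈ (z≢y , C , C⊑t , leafsC , z∈C , y∈D) z≢x (λ y≡x → x≢y (sym y≡x))

  parent-survives : ∀ {t z w₀ E} → XYCherry t → Nbr t z w₀ → z ≢ y →
                    Sub (node E) t → leaf z ∈ E → delL x E ≡ leaf z ∷ [] → ⊥
  parent-survives {z = z} {w₀} {E} (ut , x≢y , D , D⊑t , _ , x∈D , y∈D) (z≢w₀ , C , C⊑t , _ , z∈C , w₀∈C) z≢y E⊑t z∈E collapsed
    with parent-unique ut E⊑t C⊑t z∈E z∈C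
  ... | refl with w₀ ≟ x
  ...   | no w₀≢x = z≢w₀ (sym (leaf-inj (∈-singleton (subst (leaf w₀ ∈_) collapsed (leaf∈delL⁺ E w₀∈C w₀≢x)))))
  ...   | yes refl with parent-unique ut C⊑t D⊑t w₀∈C x∈D
  ...     | refl = z≢y (sym (leaf-inj (∈-singleton (subst (leaf y ∈_) collapsed (leaf∈delL⁺ E y∈D (λ y≡x → x≢y (sym y≡x)))))))

  Nbr-del-x⁻ : ∀ {t u z w w₀} → XYCherry t → u ∈ del x t → Nbr t z w₀ → z ≢ y → Nbr u z w → Nbr t z w
  Nbr-del-x⁻ {t} xy@(ut , _) u∈ nbr₀@(_ , C , C⊑t , leafsC , z∈C , _) z≢y (z≢w , ds , ds⊑u , _ , z∈ds , w∈ds)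
    with Sub-del⁻ t ds⊑u u∈
  ... | cs , cs⊑t , refl with leaf-delL⁻ cs z∈ds
  ...   | inj₂ (E , (c , c∈ , E⊑c) , z∈E , collapsed) =
            ⊥-elim (parent-survives xy nbr₀ z≢y (Sub-trans (there c∈ E⊑c) cs⊑t) z∈E collapsed)
  ...   | inj₁ z∈cs with parent-unique ut cs⊑t C⊑t z∈cs z∈C
  ...     | refl = z≢w , cs , cs⊑t , leafsC , z∈cs , leafList-delL⁻ cs leafsC w∈ds

  AllXY-del : ∀ {T z} → AllXY T → z ≢ x → z ≢ y → AllXY (delSet z T)
  AllXY-del {T} {z} allXY z≢x z≢y u u∈ =
    let (t , t∈ , u∈t) = ∈-delSet⁻ T u∈
        (ut , nbr) = allXY t t∈
    in del-unique-leaves {z} {t} ut u∈t , Nbr-del-at u∈t nbr (λ x≡z → z≢x (sym x≡z)) (λ y≡z → z≢y (sym y≡z))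

  Nonempty-del : ∀ {T z} → AllXY T → Nonempty T → z ≢ x → z ≢ y → Nonempty (delSet z T)
  Nonempty-del {T} allXY (t , t∈) z≢x z≢y =
    let (u , u∈ , _) = Nbr-del (proj₂ (allXY t t∈)) (λ x≡z → z≢x (sym x≡z)) (λ y≡z → z≢y (sym y≡z))
    in u , ∈-delSet⁺ T t∈ u∈

  -- Every tree still exists after deleting x, as y stays behind.
  survivor : ∀ {t} → XYCherry t → Σ Tree (λ u → u ∈ del x t)
  survivor (_ , nbr) = del-nonempty nbr

  -- A neighbor of z in t yields a neighbor of z in t ∖ {x} (x is replaced by y).
  neighbor-del-x : ∀ {t u z w} → XYCherry t → u ∈ del x t → z ≢ x → z ≢ y → Nbr t z w →
                   Σ ℕ (λ w′ → Nbr u z w′)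
  neighbor-del-x {w = w} xy u∈ z≢x z≢y nbr with w ≟ x
  ... | yes refl = y , Nbr-x⇒Nbr-y xy u∈ nbr z≢y
  ... | no w≢x = w , Nbr-del-at u∈ nbr z≢x w≢x

  InH-del-x : ∀ {X T z} → AllXY T → z ≢ x → z ≢ y → InH X T z → InH (remove x X) (delSet x T) z
  InH-del-x {X} {T} allXY z≢x z≢y (z∈X , hasNbr) = ∈-remove⁺ z∈X z≢x , λ u u∈ →
    let (t , t∈ , u∈t) = ∈-delSet⁻ T u∈
    in neighbor-del-x (allXY t t∈) u∈t z≢x z≢y (proj₂ (hasNbr t t∈))

  cover-del-x⁻ : ∀ {T z S} → AllXY T → z ≢ y → (∀ t → t ∈ T → Σ ℕ (λ w → Nbr t z w)) →
                 NeighborCover (delSet x T) z S → NeighborCover T z S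
  cover-del-x⁻ {T} allXY z≢y hasNbr (covered , covers) =
    (λ v v∈ →
       let (u , u∈ , nbr) = covered v v∈
           (t , t∈ , u∈t) = ∈-delSet⁻ T u∈
       in t , t∈ , Nbr-del-x⁻ (allXY t t∈) u∈t (proj₂ (hasNbr t t∈)) z≢y nbr) ,
    (λ t t∈ →
       let (u , u∈t) = survivor (allXY t t∈)
           (v , v∈ , nbr) = covers u (∈-delSet⁺ T t∈ u∈t)
       in v , v∈ , Nbr-del-x⁻ (allXY t t∈) u∈t (proj₂ (hasNbr t t∈)) z≢y nbr)

  cover-del-x-avoiding : ∀ {T z S} → AllXY T → z ≢ x → x ∉ S →
                         NeighborCover T z S → NeighborCover (delSet x T) z S
  cover-del-x-avoiding {T} {z} {S} allXY z≢x x∉S (covered , covers) =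
    (λ v v∈ →
       let (t , t∈ , nbr) = covered v v∈
           (u , u∈t) = survivor (allXY t t∈)
       in u , ∈-delSet⁺ T t∈ u∈t , Nbr-del-at u∈t nbr z≢x (≢x v∈)) ,
    (λ u u∈ →
       let (t , t∈ , u∈t) = ∈-delSet⁻ T u∈
           (v , v∈ , nbr) = covers t t∈
       in v , v∈ , Nbr-del-at u∈t nbr z≢x (≢x v∈))
    where
    ≢x : ∀ {v} → v ∈ S → v ≢ x
    ≢x v∈ v≡x = x∉S (subst (_∈ S) v≡x v∈)

  cover-del-x-replacing : ∀ {T z S} → AllXY T → z ≢ x → z ≢ y → x ∈ S → NeighborCover T z S →
                          NeighborCover (delSet x T) z (y ∷ remove y (remove x S))
  cover-del-x-replacing {T} {z} {S} allXY z≢x z≢y x∈S (covered , covers) = covered′ , covers′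
    where
    covered′ : ∀ v → v ∈ y ∷ remove y (remove x S) → Σ Tree (λ u → u ∈ delSet x T × Nbr u z v)
    covered′ v (here refl) =
      let (t , t∈ , nbr) = covered x x∈S
          (u , u∈t) = survivor (allXY t t∈)
      in u , ∈-delSet⁺ T t∈ u∈t , Nbr-x⇒Nbr-y (allXY t t∈) u∈t nbr z≢y
    covered′ v (there v∈R) =
      let (v∈ , _) = ∈-remove⁻ (remove x S) v∈R
          (v∈S , v≢x) = ∈-remove⁻ S v∈
          (t , t∈ , nbr) = covered v v∈S
          (u , u∈t) = survivor (allXY t t∈)
      in u , ∈-delSet⁺ T t∈ u∈t , Nbr-del-at u∈t nbr z≢x v≢x
    covers′ : ∀ u → u ∈ delSet x T → Σ ℕ (λ v → v ∈ y ∷ remove y (remove x S) × Nbr u z v)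
    covers′ u u∈ with ∈-delSet⁻ T u∈
    ... | t , t∈ , u∈t with covers t t∈
    ...   | v , v∈ , nbr with v ≟ x | v ≟ y
    ...     | yes refl | _ = y , here refl , Nbr-x⇒Nbr-y (allXY t t∈) u∈t nbr z≢y
    ...     | no v≢x | yes refl = y , here refl , Nbr-del-at u∈t nbr z≢x v≢x
    ...     | no v≢x | no v≢y =
              v , there (∈-remove⁺ (∈-remove⁺ v∈ v≢x) v≢y) , Nbr-del-at u∈t nbr z≢x v≢x

  replace-unique : ∀ {S} → Unique S → Unique (y ∷ remove y (remove x S))
  replace-unique {S} uS =
    All.tabulate (λ v∈ y≡v → proj₂ (∈-remove⁻ (remove x S) v∈) (sym y≡v))
    ∷ remove-unique (remove x S) (remove-unique S uS)

  replace-length : ∀ {S} → x ∈ S → length (y ∷ remove y (remove x S)) ≤ length S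
  replace-length {S} x∈S =
    ≤-trans (s≤s (length-filter (λ v → ¬? (v ≟ y)) (remove x S))) (remove-length S x∈S)

  cover-del-x⁺ : ∀ {T z S} → AllXY T → z ≢ x → z ≢ y → Unique S → NeighborCover T z S →
                 Σ (List ℕ) (λ S′ → Unique S′ × NeighborCover (delSet x T) z S′ × length S′ ≤ length S)
  cover-del-x⁺ {S = S} allXY z≢x z≢y uS cover with x ∈? S
  ... | no x∉S = S , uS , cover-del-x-avoiding allXY z≢x x∉S cover , ≤-refl
  ... | yes x∈S = y ∷ remove y (remove x S) , replace-unique uS ,
                  cover-del-x-replacing allXY z≢x z≢y x∈S cover , replace-length x∈S

  Weight-del-x : ∀ {X T z w} → AllXY T → z ≢ x → z ≢ y → InH X T z → Weight T z w → Weight (delSet x T) z w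
  Weight-del-x allXY z≢x z≢y (_ , hasNbr) (m , ((S , uS , cover , |S|≡m) , minimal) , w≡) =
    let (S′ , uS′ , cover′ , |S′|≤|S|) = cover-del-x⁺ allXY z≢x z≢y uS cover
        m≤|S′| = minimal S′ uS′ (cover-del-x⁻ allXY z≢y hasNbr cover′)
        |S′|≡m = ≤-antisym (subst (length S′ ≤_) |S|≡m |S′|≤|S|) m≤|S′|
    in m , ((S′ , uS′ , cover′ , |S′|≡m) ,
            (λ S₂ uS₂ cover₂ → minimal S₂ uS₂ (cover-del-x⁻ allXY z≢y hasNbr cover₂))) , w≡

  -- {y} is a minimum neighbor cover of x, so x has weight zero.
  Weight-x≡0 : ∀ {T w} → AllXY T → Nonempty T → Weight T x w → w ≡ + 0
  Weight-x≡0 {T} allXY (t₀ , t₀∈) (m , ((S , _ , (_ , covers) , |S|≡m) , minimal) , w≡) =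
    trans w≡ (cong (λ k → + k - + 1) (≤-antisym m≤1 1≤m))
    where
    cover-y : NeighborCover T x (y ∷ [])
    cover-y = (λ v v∈ → t₀ , t₀∈ , subst (Nbr t₀ x) (sym (∈-singleton v∈)) (proj₂ (allXY t₀ t₀∈))) ,
              (λ t t∈ → y , here refl , proj₂ (allXY t t∈))
    m≤1 : m ≤ 1
    m≤1 = minimal (y ∷ []) ([] ∷ []) cover-y
    1≤m : 1 ≤ m
    1≤m = let (_ , v∈ , _) = covers t₀ t₀∈ in subst (1 ≤_) |S|≡m (member⇒nonempty v∈)

  Avoids : List ℕ → Set
  Avoids p = All (λ z → z ≢ x × z ≢ y) p

  data FirstOccurrence : List ℕ → Set where
    x-first : ∀ p q → Avoids p → FirstOccurrence (p ++ x ∷ q)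
    y-first : ∀ p q → Avoids p → FirstOccurrence (p ++ y ∷ q)
    neither : ∀ {s} → Avoids s → FirstOccurrence s

  firstOccurrence : ∀ s → FirstOccurrence s
  firstOccurrence [] = neither []
  firstOccurrence (z ∷ s) with z ≟ x | z ≟ y
  ... | yes refl | _ = x-first [] s []
  ... | no _ | yes refl = y-first [] s []
  ... | no z≢x | no z≢y with firstOccurrence s
  ...   | x-first p q avoids = x-first (z ∷ p) q ((z≢x , z≢y) ∷ avoids)
  ...   | y-first p q avoids = y-first (z ∷ p) q ((z≢x , z≢y) ∷ avoids)
  ...   | neither avoids = neither ((z≢x , z≢y) ∷ avoids)

  -- A sequence avoiding two distinct leaves of X leaves at least both of them
  -- unpicked, so it is too short to be a cherry picking sequence.
  avoiding-short : ∀ s {X T} → ValidSeq X T s → x ∈ X → y ∈ X → x ≢ y → Avoids s →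
                   suc (suc (length s)) ≤ length X
  avoiding-short [] {X} _ x∈X y∈X x≢y _ = two-members X x∈X y∈X x≢y
  avoiding-short (z ∷ s) {X} (z∈H , valid) x∈X y∈X x≢y ((z≢x , z≢y) ∷ avoids) =
    ≤-trans (s≤s (avoiding-short s valid (∈-remove⁺ x∈X (λ x≡z → z≢x (sym x≡z)))
                                         (∈-remove⁺ y∈X (λ y≡z → z≢y (sym y≡z))) x≢y avoids))
            (remove-length X (proj₁ z∈H))

  ValidSeq-x-first : ∀ p {q X T} → AllXY T → Avoids p →
                     ValidSeq X T (p ++ x ∷ q) → ValidSeq (remove x X) (delSet x T) (p ++ q)
  ValidSeq-x-first [] _ _ (_ , valid) = valid
  ValidSeq-x-first (z ∷ p) {q} {X} {T} allXY ((z≢x , z≢y) ∷ avoids) (z∈H , valid) =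
    InH-del-x allXY z≢x z≢y z∈H ,
    subst₂ (λ X′ T′ → ValidSeq X′ T′ (p ++ q)) (remove-comm x z X) (delSet-comm z x T)
      (ValidSeq-x-first p (AllXY-del allXY z≢x z≢y) avoids valid)

  SeqWeight-x-first : ∀ p {q X T k} → AllXY T → Nonempty T → Avoids p → ValidSeq X T (p ++ x ∷ q) →
                      SeqWeight X T (p ++ x ∷ q) k → SeqWeight (remove x X) (delSet x T) (p ++ q) k
  SeqWeight-x-first [] allXY nonempty _ _ (wcons weight-x rest)
    rewrite Weight-x≡0 allXY nonempty weight-x = subst (SeqWeight _ _ _) (sym (+-identityˡ _)) rest
  SeqWeight-x-first (z ∷ p) {q} {X} {T} allXY nonempty ((z≢x , z≢y) ∷ avoids) (z∈H , valid) (wcons weight-z rest) =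
    wcons (Weight-del-x allXY z≢x z≢y z∈H weight-z)
      (subst₂ (λ X′ T′ → SeqWeight X′ T′ (p ++ q) _) (remove-comm x z X) (delSet-comm z x T)
        (SeqWeight-x-first p (AllXY-del allXY z≢x z≢y) (Nonempty-del allXY nonempty z≢x z≢y) avoids valid rest))

  x-to-front : ∀ {X T k} → AllXY T → Nonempty T → InH X T x → Weight T x (+ 0) → ∀ p q → Avoids p →
               CPS X T (p ++ x ∷ q) → SeqWeight X T (p ++ x ∷ q) k →
               Σ (List ℕ) (λ s′ → CPS X T (x ∷ s′) × SeqWeight X T (x ∷ s′) k)
  x-to-front {X} {T} {k} allXY nonempty x∈H weight-x p q avoids (len , valid) weight =
    p ++ q ,
    (trans (cong suc (sym (length-++-sucʳ p x q))) len , x∈H , ValidSeq-x-first p allXY avoids valid) ,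
    subst (SeqWeight X T (x ∷ p ++ q)) (+-identityˡ k) (wcons weight-x (SeqWeight-x-first p allXY nonempty avoids valid weight))

mutual
  data _≈_ : Tree → Tree → Set where
    leaf≈ : ∀ {a} → leaf a ≈ leaf a
    node≈ : ∀ {cs ds} → cs ≈* ds → node cs ≈ node ds

  data _≈*_ : List Tree → List Tree → Set where
    []    : [] ≈* []
    _∷_   : ∀ {c d cs ds} → c ≈ d → cs ≈* ds → (c ∷ cs) ≈* (d ∷ ds)
    swap  : ∀ {c d cs} → (c ∷ d ∷ cs) ≈* (d ∷ c ∷ cs)
    trans* : ∀ {cs ds es} → cs ≈* ds → ds ≈* es → cs ≈* es

mutual
  ≈-refl : ∀ t → t ≈ t
  ≈-refl (leaf a) = leaf≈
  ≈-refl (node cs) = node≈ (≈*-refl cs)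

  ≈*-refl : ∀ cs → cs ≈* cs
  ≈*-refl [] = []
  ≈*-refl (c ∷ cs) = ≈-refl c ∷ ≈*-refl cs

mutual
  ≈-sym : ∀ {t u} → t ≈ u → u ≈ t
  ≈-sym leaf≈ = leaf≈
  ≈-sym (node≈ p) = node≈ (≈*-sym p)

  ≈*-sym : ∀ {cs ds} → cs ≈* ds → ds ≈* cs
  ≈*-sym [] = []
  ≈*-sym (p ∷ ps) = ≈-sym p ∷ ≈*-sym ps
  ≈*-sym swap = swap
  ≈*-sym (trans* p q) = trans* (≈*-sym q) (≈*-sym p)

≈-trans : ∀ {t u v} → t ≈ u → u ≈ v → t ≈ v
≈-trans leaf≈ leaf≈ = leaf≈
≈-trans (node≈ p) (node≈ q) = node≈ (trans* p q)

≡⇒≈ : ∀ {t u} → t ≡ u → t ≈ u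
≡⇒≈ {t} refl = ≈-refl t

≡⇒≈* : ∀ {cs ds} → cs ≡ ds → cs ≈* ds
≡⇒≈* {cs} refl = ≈*-refl cs

≈*-length : ∀ {cs ds} → cs ≈* ds → length cs ≡ length ds
≈*-length [] = refl
≈*-length (_ ∷ ps) = cong suc (≈*-length ps)
≈*-length swap = refl
≈*-length (trans* p q) = trans (≈*-length p) (≈*-length q)

≈*-singleton : ∀ {c d} → (c ∷ []) ≈* (d ∷ []) → c ≈ d
≈*-singleton (p ∷ _) = p
≈*-singleton (trans* {ds = []} p q) = case ≈*-length p of λ ()
≈*-singleton (trans* {ds = _ ∷ []} p q) = ≈-trans (≈*-singleton p) (≈*-singleton q)
≈*-singleton (trans* {ds = _ ∷ _ ∷ _} p q) = case ≈*-length p of λ ()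

collapse-≈ : ∀ {L M} → L ≈* M → collapse L ≈* collapse M
collapse-≈ {[]} {[]} _ = []
collapse-≈ {c ∷ []} {d ∷ []} p = ≈*-singleton p ∷ []
collapse-≈ {c ∷ c′ ∷ L} {d ∷ d′ ∷ M} p = node≈ p ∷ []
collapse-≈ {[]} {_ ∷ _} p = case ≈*-length p of λ ()
collapse-≈ {_ ∷ _} {[]} p = case ≈*-length p of λ ()
collapse-≈ {c ∷ []} {d ∷ _ ∷ _} p = case ≈*-length p of λ ()
collapse-≈ {c ∷ _ ∷ _} {d ∷ []} p = case ≈*-length p of λ ()

++-≈*ˡ : ∀ {cs ds} es → cs ≈* ds → (cs ++ es) ≈* (ds ++ es)
++-≈*ˡ es [] = ≈*-refl es
++-≈*ˡ es (p ∷ ps) = p ∷ ++-≈*ˡ es ps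
++-≈*ˡ es swap = swap
++-≈*ˡ es (trans* p q) = trans* (++-≈*ˡ es p) (++-≈*ˡ es q)

++-≈*ʳ : ∀ cs {es fs} → es ≈* fs → (cs ++ es) ≈* (cs ++ fs)
++-≈*ʳ [] q = q
++-≈*ʳ (c ∷ cs) q = ≈-refl c ∷ ++-≈*ʳ cs q

++-≈* : ∀ {cs ds es fs} → cs ≈* ds → es ≈* fs → (cs ++ es) ≈* (ds ++ fs)
++-≈* {ds = ds} {es = es} p q = trans* (++-≈*ˡ es p) (++-≈*ʳ ds q)

small-swap : ∀ {A B} R → Small A → Small B → (A ++ (B ++ R)) ≈* (B ++ (A ++ R))
small-swap R (inj₁ refl) _ = ≈*-refl _
small-swap R (inj₂ (_ , refl)) (inj₁ refl) = ≈*-refl _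
small-swap R (inj₂ (_ , refl)) (inj₂ (_ , refl)) = swap

mutual
  del-≈ : ∀ {a t u} → t ≈ u → del a t ≈* del a u
  del-≈ leaf≈ = ≈*-refl _
  del-≈ (node≈ p) = collapse-≈ (delL-≈ p)

  delL-≈ : ∀ {a cs ds} → cs ≈* ds → delL a cs ≈* delL a ds
  delL-≈ [] = []
  delL-≈ (p ∷ ps) = ++-≈* (del-≈ p) (delL-≈ ps)
  delL-≈ {a} (swap {c} {d} {cs}) = small-swap (delL a cs) (del-small a c) (del-small a d)
  delL-≈ (trans* p q) = trans* (delL-≈ p) (delL-≈ q)

≈*-∈ : ∀ {cs ds c} → cs ≈* ds → c ∈ cs → Σ Tree (λ d → d ∈ ds × c ≈ d)
≈*-∈ (p ∷ _) (here refl) = _ , here refl , p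
≈*-∈ (_ ∷ ps) (there c∈) = let (d , d∈ , q) = ≈*-∈ ps c∈ in d , there d∈ , q
≈*-∈ swap (here refl) = _ , there (here refl) , ≈-refl _
≈*-∈ swap (there (here refl)) = _ , here refl , ≈-refl _
≈*-∈ swap (there (there c∈)) = _ , there (there c∈) , ≈-refl _
≈*-∈ (trans* p q) c∈ =
  let (d , d∈ , r) = ≈*-∈ p c∈
      (e , e∈ , r′) = ≈*-∈ q d∈
  in e , e∈ , ≈-trans r r′

Sub-≈ : ∀ {t u C} → t ≈ u → Sub (node C) t → Σ (List Tree) (λ D → Sub (node D) u × C ≈* D)
Sub-≈ (node≈ p) here = _ , here , p
Sub-≈ (node≈ p) (there c∈ sub) =
  let (d , d∈ , r) = ≈*-∈ p c∈
      (D , D⊑d , q) = Sub-≈ r sub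
  in D , there d∈ D⊑d , q

leaf-≈ : ∀ {a d} → leaf a ≈ d → d ≡ leaf a
leaf-≈ leaf≈ = refl

IsLeaf-≈ : ∀ {c d} → IsLeaf c → c ≈ d → IsLeaf d
IsLeaf-≈ isLeaf leaf≈ = isLeaf

Nbr-≈ : ∀ {t u a b} → t ≈ u → Nbr t a b → Nbr u a b
Nbr-≈ p (a≢b , C , C⊑t , leafsC , a∈C , b∈C) =
  let (D , D⊑u , q) = Sub-≈ p C⊑t
      leafsD = All.tabulate (λ d∈ → let (c , c∈ , r) = ≈*-∈ (≈*-sym q) d∈
                                     in IsLeaf-≈ (All.lookup leafsC c∈) (≈-sym r))
      leaf∈ : ∀ {v} → leaf v ∈ C → leaf v ∈ D
      leaf∈ v∈ = let (d , d∈ , r) = ≈*-∈ q v∈ in subst (_∈ D) (leaf-≈ r) d∈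
  in a≢b , D , D⊑u , leafsD , leaf∈ a∈C , leaf∈ b∈C

-- Exchanging the labels x and y in trees and sequences: the y-first case.
module LabelSwap (x y : ℕ) (x≢y : x ≢ y) where

  σ : ℕ → ℕ
  σ z with z ≟ x
  ... | yes _ = y
  ... | no _ with z ≟ y
  ...   | yes _ = x
  ...   | no _ = z

  σ-x : σ x ≡ y
  σ-x with x ≟ x
  ... | yes _ = refl
  ... | no x≢x = ⊥-elim (x≢x refl)

  σ-y : σ y ≡ x
  σ-y with y ≟ x
  ... | yes y≡x = ⊥-elim (x≢y (sym y≡x))
  ... | no _ with y ≟ y
  ...   | yes _ = refl
  ...   | no y≢y = ⊥-elim (y≢y refl)

  σ-other : ∀ {z} → z ≢ x → z ≢ y → σ z ≡ z
  σ-other {z} z≢x z≢y with z ≟ x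
  ... | yes z≡x = ⊥-elim (z≢x z≡x)
  ... | no _ with z ≟ y
  ...   | yes z≡y = ⊥-elim (z≢y z≡y)
  ...   | no _ = refl

  σ-involutive : ∀ z → σ (σ z) ≡ z
  σ-involutive z = by-cases (z ≟ x) (z ≟ y)
    where
    by-cases : Dec (z ≡ x) → Dec (z ≡ y) → σ (σ z) ≡ z
    by-cases (yes refl) _ = trans (cong σ σ-x) σ-y
    by-cases (no _) (yes refl) = trans (cong σ σ-y) σ-x
    by-cases (no z≢x) (no z≢y) = trans (cong σ (σ-other z≢x z≢y)) (σ-other z≢x z≢y)

  σ-injective : ∀ {a b} → σ a ≡ σ b → a ≡ b
  σ-injective {a} {b} eq = trans (sym (σ-involutive a)) (trans (cong σ eq) (σ-involutive b))

  mutual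
    relabel : Tree → Tree
    relabel (leaf a) = leaf (σ a)
    relabel (node cs) = node (relabelL cs)

    relabelL : List Tree → List Tree
    relabelL [] = []
    relabelL (c ∷ cs) = relabel c ∷ relabelL cs

  relabelL-++ : ∀ A B → relabelL (A ++ B) ≡ relabelL A ++ relabelL B
  relabelL-++ [] B = refl
  relabelL-++ (a ∷ A) B = cong (relabel a ∷_) (relabelL-++ A B)

  collapse-relabelL : ∀ L → collapse (relabelL L) ≡ relabelL (collapse L)
  collapse-relabelL [] = refl
  collapse-relabelL (c ∷ []) = refl
  collapse-relabelL (c ∷ d ∷ L) = refl

  mutual
    del-relabel : ∀ a t → del (σ a) (relabel t) ≡ relabelL (del a t)
    del-relabel a (leaf b) with leafDeletion a b | leafDeletion (σ a) (σ b)
    ... | deleted _ e₁ | deleted _ e₂ rewrite e₁ | e₂ = refl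
    ... | deleted b≡a _ | kept σb≢σa _ = ⊥-elim (σb≢σa (cong σ b≡a))
    ... | kept b≢a _ | deleted σb≡σa _ = ⊥-elim (b≢a (σ-injective σb≡σa))
    ... | kept _ e₁ | kept _ e₂ rewrite e₁ | e₂ = refl
    del-relabel a (node cs) = trans (cong collapse (delL-relabelL a cs)) (collapse-relabelL (delL a cs))

    delL-relabelL : ∀ a cs → delL (σ a) (relabelL cs) ≡ relabelL (delL a cs)
    delL-relabelL a [] = refl
    delL-relabelL a (c ∷ cs) = trans (cong₂ _++_ (del-relabel a c) (delL-relabelL a cs))
                                     (sym (relabelL-++ (del a c) (delL a cs)))

  mutual
    relabel-involutive : ∀ t → relabel (relabel t) ≡ t
    relabel-involutive (leaf a) = cong leaf (σ-involutive a)
    relabel-involutive (node cs) = cong node (relabelL-involutive cs)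

    relabelL-involutive : ∀ cs → relabelL (relabelL cs) ≡ cs
    relabelL-involutive [] = refl
    relabelL-involutive (c ∷ cs) = cong₂ _∷_ (relabel-involutive c) (relabelL-involutive cs)

  ∈-relabelL⁺ : ∀ {c} cs → c ∈ cs → relabel c ∈ relabelL cs
  ∈-relabelL⁺ (c ∷ cs) (here refl) = here refl
  ∈-relabelL⁺ (c ∷ cs) (there c∈) = there (∈-relabelL⁺ cs c∈)

  ∈-relabelL⁻ : ∀ {v} cs → v ∈ relabelL cs → Σ Tree (λ c → c ∈ cs × v ≡ relabel c)
  ∈-relabelL⁻ (c ∷ cs) (here eq) = c , here refl , eq
  ∈-relabelL⁻ (c ∷ cs) (there v∈) = let (d , d∈ , eq) = ∈-relabelL⁻ cs v∈ in d , there d∈ , eq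

  Sub-relabel : ∀ {u t} → Sub u t → Sub (relabel u) (relabel t)
  Sub-relabel here = here
  Sub-relabel (there {cs = cs} c∈ sub) = there (∈-relabelL⁺ cs c∈) (Sub-relabel sub)

  IsLeaf-relabel : ∀ {c} → IsLeaf c → IsLeaf (relabel c)
  IsLeaf-relabel isLeaf = isLeaf

  Nbr-relabel : ∀ {t a b} → Nbr t a b → Nbr (relabel t) (σ a) (σ b)
  Nbr-relabel (a≢b , C , C⊑t , leafsC , a∈C , b∈C) =
    (λ eq → a≢b (σ-injective eq)) , relabelL C , Sub-relabel C⊑t ,
    All.tabulate (λ v∈ → let (c , c∈ , eq) = ∈-relabelL⁻ C v∈
                         in subst IsLeaf (sym eq) (IsLeaf-relabel (All.lookup leafsC c∈))) ,
    ∈-relabelL⁺ C a∈C , ∈-relabelL⁺ C b∈C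

  Relabels : List Tree → List Tree → Set
  Relabels T U = U ≈* relabelL T

  Relabels-∈⁺ : ∀ {T U t} → Relabels T U → t ∈ T → Σ Tree (λ u → u ∈ U × u ≈ relabel t)
  Relabels-∈⁺ {T} rel t∈ =
    let (u , u∈ , p) = ≈*-∈ (≈*-sym rel) (∈-relabelL⁺ T t∈) in u , u∈ , ≈-sym p

  Relabels-∈⁻ : ∀ {T U u} → Relabels T U → u ∈ U → Σ Tree (λ t → t ∈ T × u ≈ relabel t)
  Relabels-∈⁻ {T} rel u∈ =
    let (v , v∈ , p) = ≈*-∈ rel u∈
        (t , t∈ , eq) = ∈-relabelL⁻ T v∈
    in t , t∈ , subst (_ ≈_) eq p

  Nbr-Relabels⁺ : ∀ {t u a b} → u ≈ relabel t → Nbr t a b → Nbr u (σ a) (σ b)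
  Nbr-Relabels⁺ p nbr = Nbr-≈ (≈-sym p) (Nbr-relabel nbr)

  Nbr-Relabels⁻ : ∀ {t u a c} → u ≈ relabel t → Nbr u (σ a) c → Nbr t a (σ c)
  Nbr-Relabels⁻ {t} {a = a} p nbr =
    subst₂ (λ v b → Nbr v b _) (relabel-involutive t) (σ-involutive a) (Nbr-relabel (Nbr-≈ p nbr))

  Relabels-del : ∀ {T U a} → Relabels T U → Relabels (delSet a T) (delSet (σ a) U)
  Relabels-del {T} {U} {a} rel =
    subst₂ _≈*_ (sym (delSet≡delL (σ a) U))
      (trans (delL-relabelL a T) (cong relabelL (sym (delSet≡delL a T))))
      (delL-≈ rel)

  MapsInto : List ℕ → List ℕ → Set
  MapsInto X X′ = ∀ b → b ∈ X → σ b ∈ X′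

  MapsInto-remove : ∀ {X X′} a → MapsInto X X′ → MapsInto (remove a X) (remove (σ a) X′)
  MapsInto-remove {X} a into b b∈ =
    let (b∈X , b≢a) = ∈-remove⁻ X b∈ in ∈-remove⁺ (into b b∈X) (λ eq → b≢a (σ-injective eq))

  InH-relabel : ∀ {X X′ T U a} → MapsInto X X′ → Relabels T U → InH X T a → InH X′ U (σ a)
  InH-relabel {a = a} into rel (a∈X , hasNbr) = into a a∈X , λ u u∈ →
    let (t , t∈ , p) = Relabels-∈⁻ rel u∈
        (w , nbr) = hasNbr t t∈
    in σ w , Nbr-Relabels⁺ p nbr

  cover-relabel⁺ : ∀ {T U a S} → Relabels T U → NeighborCover T a S → NeighborCover U (σ a) (map σ S)
  cover-relabel⁺ {a = a} rel (covered , covers) =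
    (λ v v∈ →
       let (b , b∈ , eq) = ∈-map⁻ σ v∈
           (t , t∈ , nbr) = covered b b∈
           (u , u∈ , p) = Relabels-∈⁺ rel t∈
       in u , u∈ , subst (Nbr u (σ a)) (sym eq) (Nbr-Relabels⁺ p nbr)) ,
    (λ u u∈ →
       let (t , t∈ , p) = Relabels-∈⁻ rel u∈
           (b , b∈ , nbr) = covers t t∈
       in σ b , ∈-map⁺ σ b∈ , Nbr-Relabels⁺ p nbr)

  cover-relabel⁻ : ∀ {T U a S} → Relabels T U → NeighborCover U (σ a) S → NeighborCover T a (map σ S)
  cover-relabel⁻ {a = a} rel (covered , covers) =
    (λ v v∈ →
       let (c , c∈ , eq) = ∈-map⁻ σ v∈
           (u , u∈ , nbr) = covered c c∈
           (t , t∈ , p) = Relabels-∈⁻ rel u∈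
       in t , t∈ , subst (Nbr t a) (sym eq) (Nbr-Relabels⁻ p nbr)) ,
    (λ t t∈ →
       let (u , u∈ , p) = Relabels-∈⁺ rel t∈
           (c , c∈ , nbr) = covers u u∈
       in σ c , ∈-map⁺ σ c∈ , Nbr-Relabels⁻ p nbr)

  Weight-relabel : ∀ {T U a w} → Relabels T U → Weight T a w → Weight U (σ a) w
  Weight-relabel rel (m , ((S , uS , cover , |S|≡m) , minimal) , w≡) =
    m , ((map σ S , Unique.map⁺ σ-injective uS , cover-relabel⁺ rel cover , trans (length-map σ S) |S|≡m) ,
         (λ S₂ uS₂ cover₂ → subst (m ≤_) (length-map σ S₂)
                              (minimal (map σ S₂) (Unique.map⁺ σ-injective uS₂) (cover-relabel⁻ rel cover₂)))) ,
    w≡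

  ValidSeq-relabel : ∀ s {X X′ T U} → MapsInto X X′ → Relabels T U → ValidSeq X T s → ValidSeq X′ U (map σ s)
  ValidSeq-relabel [] into rel _ = tt
  ValidSeq-relabel (a ∷ s) into rel (a∈H , valid) =
    InH-relabel into rel a∈H , ValidSeq-relabel s (MapsInto-remove a into) (Relabels-del rel) valid

  SeqWeight-relabel : ∀ {X T s k} X′ {U} → Relabels T U → SeqWeight X T s k → SeqWeight X′ U (map σ s) k
  SeqWeight-relabel X′ rel wnil = wnil
  SeqWeight-relabel X′ rel (wcons {x = a} weight rest) =
    wcons (Weight-relabel rel weight) (SeqWeight-relabel (remove (σ a) X′) (Relabels-del rel) rest)

  mutual
    relabel-fixed : ∀ t → (∀ v → v ∈ leaves t → σ v ≡ v) → relabel t ≡ t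
    relabel-fixed (leaf a) fixed = cong leaf (fixed a (here refl))
    relabel-fixed (node cs) fixed = cong node (relabelL-fixed cs fixed)

    relabelL-fixed : ∀ cs → (∀ v → v ∈ leavesL cs → σ v ≡ v) → relabelL cs ≡ cs
    relabelL-fixed [] fixed = refl
    relabelL-fixed (c ∷ cs) fixed =
      cong₂ _∷_ (relabel-fixed c (λ v v∈ → fixed v (∈-++⁺ˡ v∈)))
                (relabelL-fixed cs (λ v v∈ → fixed v (∈-++⁺ʳ (leaves c) v∈)))

  head-disjoint : ∀ {v} d cs → Unique (leavesL (d ∷ cs)) → v ∈ leaves d → v ∈ leavesL cs → ⊥
  head-disjoint d cs u = proj₂ (proj₂ (unique-++⁻ (leaves d) u))

  tail-unique : ∀ d cs → Unique (leavesL (d ∷ cs)) → Unique (leavesL cs)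
  tail-unique d cs u = proj₁ (proj₂ (unique-++⁻ (leaves d) u))

  FixesOthers : ℕ → ℕ → Set
  FixesOthers a b = ∀ v → v ≢ a → v ≢ b → σ v ≡ v

  relabel-one-leaf : ∀ {a b} → σ a ≡ b → FixesOthers a b → ∀ cs → Unique (leavesL cs) →
                     leaf a ∈ cs → b ∉ leavesL cs → (leaf a ∷ relabelL cs) ≈* (leaf b ∷ cs)
  relabel-one-leaf {a} {b} σa≡b fixes (d ∷ cs) u (here refl) b∉ =
    trans* swap (≡⇒≈* (cong₂ (λ w R → leaf w ∷ leaf a ∷ R) σa≡b rest-fixed))
    where
    rest-fixed : relabelL cs ≡ cs
    rest-fixed = relabelL-fixed cs (λ v v∈ →
      fixes v (λ v≡a → head-disjoint d cs u (here v≡a) v∈)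
              (λ v≡b → b∉ (∈-++⁺ʳ (a ∷ []) (subst (_∈ leavesL cs) v≡b v∈))))
  relabel-one-leaf {a} {b} σa≡b fixes (d ∷ cs) u (there a∈) b∉ =
    trans* swap (trans* (≡⇒≈ d-fixed ∷ relabel-one-leaf σa≡b fixes cs (tail-unique d cs u) a∈ b∉cs) swap)
    where
    d-fixed : relabel d ≡ d
    d-fixed = relabel-fixed d (λ v v∈ →
      fixes v (λ v≡a → head-disjoint d cs u v∈ (subst (_∈ leavesL cs) (sym v≡a) (leaf∈⇒label∈ cs a∈)))
              (λ v≡b → b∉ (∈-++⁺ˡ (subst (_∈ leaves d) v≡b v∈))))
    b∉cs : b ∉ leavesL cs
    b∉cs b∈ = b∉ (∈-++⁺ʳ (leaves d) b∈)

  relabel-siblings : ∀ cs → Unique (leavesL cs) → leaf x ∈ cs → leaf y ∈ cs → relabelL cs ≈* cs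
  relabel-siblings (d ∷ cs) u (here refl) (here y≡x) = ⊥-elim (x≢y (sym (leaf-inj y≡x)))
  relabel-siblings (d ∷ cs) u (here refl) (there y∈) =
    subst (λ w → (leaf w ∷ relabelL cs) ≈* (leaf x ∷ cs)) (sym σ-x)
      (relabel-one-leaf σ-y (λ v v≢y v≢x → σ-other v≢x v≢y) cs (tail-unique d cs u) y∈
        (λ x∈ → head-disjoint d cs u (here refl) x∈))
  relabel-siblings (d ∷ cs) u (there x∈) (here refl) =
    subst (λ w → (leaf w ∷ relabelL cs) ≈* (leaf y ∷ cs)) (sym σ-y)
      (relabel-one-leaf σ-x (λ v v≢x v≢y → σ-other v≢x v≢y) cs (tail-unique d cs u) x∈
        (λ y∈ → head-disjoint d cs u (here refl) y∈))
  relabel-siblings (d ∷ cs) u (there x∈) (there y∈) =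
    ≡⇒≈ (relabel-fixed d (λ v v∈ →
      σ-other (λ v≡x → head-disjoint d cs u v∈ (subst (_∈ leavesL cs) (sym v≡x) (leaf∈⇒label∈ cs x∈)))
              (λ v≡y → head-disjoint d cs u v∈ (subst (_∈ leavesL cs) (sym v≡y) (leaf∈⇒label∈ cs y∈)))))
    ∷ relabel-siblings cs (tail-unique d cs u) x∈ y∈

  relabel-child : ∀ {c} cs → Unique (leavesL cs) → c ∈ cs → relabel c ≈ c →
                  x ∈ leaves c → y ∈ leaves c → relabelL cs ≈* cs
  relabel-child (d ∷ cs) u (here refl) d≈ x∈ y∈ =
    d≈ ∷ ≡⇒≈* (relabelL-fixed cs (λ v v∈ →
      σ-other (λ v≡x → head-disjoint d cs u (subst (_∈ leaves d) (sym v≡x) x∈) v∈)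
              (λ v≡y → head-disjoint d cs u (subst (_∈ leaves d) (sym v≡y) y∈) v∈)))
  relabel-child (d ∷ cs) u (there c∈) c≈ x∈ y∈ =
    ≡⇒≈ (relabel-fixed d (λ v v∈ →
      σ-other (λ v≡x → head-disjoint d cs u v∈ (subst (_∈ leavesL cs) (sym v≡x) (∈-leavesL cs c∈ x∈)))
              (λ v≡y → head-disjoint d cs u v∈ (subst (_∈ leavesL cs) (sym v≡y) (∈-leavesL cs c∈ y∈)))))
    ∷ relabel-child cs (tail-unique d cs u) c∈ c≈ x∈ y∈

  relabel-cherry : ∀ {t C} → Unique (leaves t) → Sub (node C) t → leaf x ∈ C → leaf y ∈ C → relabel t ≈ t
  relabel-cherry {C = C} u here x∈ y∈ = node≈ (relabel-siblings C u x∈ y∈)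
  relabel-cherry {C = C} u (there {cs = cs} c∈ sub) x∈ y∈ =
    node≈ (relabel-child cs u c∈ (relabel-cherry (unique-child cs u c∈) sub x∈ y∈)
                         (Sub-leaves sub (leaf∈⇒label∈ C x∈)) (Sub-leaves sub (leaf∈⇒label∈ C y∈)))

  Relabels-self : ∀ T → (∀ t → t ∈ T → relabel t ≈ t) → Relabels T T
  Relabels-self [] _ = []
  Relabels-self (t ∷ T) invariant = ≈-sym (invariant t (here refl)) ∷ Relabels-self T (λ t′ t′∈ → invariant t′ (there t′∈))

  open CherryDeletion x y using (Avoids)

  y-first⇒x-first : ∀ {X T k} → TreesOn X T → (∀ t → t ∈ T → Nbr t x y) → x ∈ X → y ∈ X →
                    ∀ p q → Avoids p → CPS X T (p ++ y ∷ q) → SeqWeight X T (p ++ y ∷ q) k →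
                    Avoids (map σ p) × CPS X T (map σ p ++ x ∷ map σ q) × SeqWeight X T (map σ p ++ x ∷ map σ q) k
  y-first⇒x-first {X} {T} {k} trees x~y x∈X y∈X p q avoids (len , valid) weight =
    avoids′ ,
    subst (CPS X T) swapped (trans (cong suc (length-map σ (p ++ y ∷ q))) len , ValidSeq-relabel _ into self valid) ,
    subst (λ s → SeqWeight X T s k) swapped (SeqWeight-relabel X self weight)
    where
    tree : ∀ {t} → t ∈ T → TreeOn X t
    tree t∈ = All.lookup (TreesOn.trees trees) t∈
    self : Relabels T T
    self = Relabels-self T (λ t t∈ → let (_ , C , C⊑t , _ , x∈C , y∈C) = x~y t t∈
                                     in relabel-cherry (TreeOn.uniq (tree t∈)) C⊑t x∈C y∈C)
    into : MapsInto X X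
    into b b∈X with b ≟ x
    ... | yes _ = y∈X
    ... | no _ with b ≟ y
    ...   | yes _ = x∈X
    ...   | no _ = b∈X
    swapped : map σ (p ++ y ∷ q) ≡ map σ p ++ x ∷ map σ q
    swapped = trans (map-++ σ p (y ∷ q)) (cong (λ w → map σ p ++ w ∷ map σ q) σ-y)
    avoids′ : Avoids (map σ p)
    avoids′ = All.map⁺ (All.map (λ { (z≢x , z≢y) → subst (λ w → w ≢ x × w ≢ y) (sym (σ-other z≢x z≢y)) (z≢x , z≢y) }) avoids)

weight-zero-partner : ∀ {T x} → Weight T x (+ 0) →
                      Σ ℕ (λ y → (∀ t → t ∈ T → Nbr t x y) × Σ Tree (λ t → t ∈ T))
weight-zero-partner {T} {x} (m , ((S , _ , (covered , covers) , |S|≡m) , _) , w≡0)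
  with length-one S (trans |S|≡m (weight-zero⇒size-one m (sym w≡0)))
... | y , refl = y , partner , (proj₁ (covered y (here refl)) , proj₁ (proj₂ (covered y (here refl))))
  where
  partner : ∀ t → t ∈ T → Nbr t x y
  partner t t∈ = let (v , v∈ , nbr) = covers t t∈ in subst (Nbr t x) (∈-singleton v∈) nbr

mainTheorem15 : (X : List ℕ) (T : List Tree) → TreesOn X T →
    (s : List ℕ) → CPS X T s →
    (x : ℕ) → InH X T x → Weight T x (+ 0) →
    (k : ℤ) → SeqWeight X T s k →
    Σ (List ℕ) (λ s′ → CPS X T (x ∷ s′) × SeqWeight X T (x ∷ s′) k)
mainTheorem15 X T trees s (len , valid) x x∈H weight-x k weight
  with weight-zero-partner weight-x
... | y , x~y , (t₀ , t₀∈) = by-first-occurrence (firstOccurrence s) len valid weight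
  where
  open CherryDeletion x y
  x≢y : x ≢ y
  x≢y = proj₁ (x~y t₀ t₀∈)
  y∈X : y ∈ X
  y∈X = proj₁ (TreeOn.leafSet (All.lookup (TreesOn.trees trees) t₀∈) y) (Nbr-leaves (x~y t₀ t₀∈))
  allXY : AllXY T
  allXY t t∈ = TreeOn.uniq (All.lookup (TreesOn.trees trees) t∈) , x~y t t∈
  by-first-occurrence : ∀ {s} → FirstOccurrence s → suc (length s) ≡ length X → ValidSeq X T s →
                        SeqWeight X T s k → Σ (List ℕ) (λ s′ → CPS X T (x ∷ s′) × SeqWeight X T (x ∷ s′) k)
  by-first-occurrence (x-first p q avoids) len valid weight =
    x-to-front allXY (t₀ , t₀∈) x∈H weight-x p q avoids (len , valid) weight
  by-first-occurrence (y-first p q avoids) len valid weight =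
    let open LabelSwap x y x≢y
        (avoids′ , cps′ , weight′) = y-first⇒x-first trees x~y (proj₁ x∈H) y∈X p q avoids (len , valid) weight
    in x-to-front allXY (t₀ , t₀∈) x∈H weight-x (map σ p) (map σ q) avoids′ cps′ weight′
  by-first-occurrence {s} (neither avoids) len valid _ =
    ⊥-elim (1+n≰n (subst (suc (suc (length s)) ≤_) (sym len) (avoiding-short s valid (proj₁ x∈H) y∈X x≢y avoids)))
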